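{- Let $i\ge 2$, let $K_i$ be the complete graph on $[i]=\{1,\ldots,i\}$, and let $I\subseteq\mathbb{K}[x_e: e\in E(K_i)]$ be the cut ideal of $K_i$. For $j\ge 1$ let $I_{i,j}$ denote the $j$-fold lcm-ideal of $I$, and for $d\ge 1$ let $P_{i,d}$ be the ideal generated by the monomials $m_C$ of all $d$-partitions $C$ of $[i]$. Then for every integer $k\ge 1$, $$I_{i,2^{k-1}}=I_{i,2^{k-1}+1}=\cdots=I_{i,2^k-1}=P_{i,k+1}.$$ Moreover, the number of minimal monomial generators of $P_{i,k+1}$ is the Stirling number of the second kind $S(i,k+1)$.
   Context: $\mathbb{K}$ is a field. A $d$-partition of $[i]$ is a partition $C=A_1|\cdots|A_d$ of $[i]$ into $d$ pairwise disjoint nonempty blocks (in $K_i$ all of these are $d$-cuts, since each block induces a connected subgraph). $E(C)$ is the set of edges $\{a,b\}$ of $K_i$ with endpoints in different blocks, and $m_C=\prod_{e\in E(C)}x_e$. The cut ideal of $K_i$ is the ideal generated by all $m_C$ with $C$ a $2$-partition of $[i]$. For a monomial ideal $J$ with minimal monomial generating set $\{m_1,\ldots,m_r\}$, the $j$-fold lcm-ideal of $J$ is the ideal generated by $\operatorname{lcm}(\{m_t\}_{t\in\sigma})$ for all $\sigma\subseteq\{1,\ldots,r\}$ with $|\sigma|=j$ (so it is the zero ideal when $j>r$). $S(i,d)$ is the number of partitions of an $i$-element set into $d$ nonempty blocks. -}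

module Defs where

open import Data.Nat using (ℕ; zero; suc; _+_; _*_; _≤_; _⊔_)
open import Data.Fin as Fin using (Fin; _<?_)
open import Data.Fin.Properties using (_≟_)
open import Data.List using (List; concatMap; map; filter; allFin; length)
open import Data.List.Relation.Unary.Unique.Propositional using (Unique)
open import Data.List.Membership.Propositional using (_∈_)
open import Data.Vec as Vec using (Vec; tabulate; replicate; zipWith; foldr)
open import Data.Vec.Relation.Binary.Pointwise.Inductive using (Pointwise)
open import Data.Vec.Relation.Unary.All using (All)
open import Data.Vec.Relation.Unary.AllPairs using (AllPairs)
open import Data.Product using (Σ; _×_; _,_; ∃; ∃-syntax)
open import Relation.Binary.PropositionalEquality using (_≡_; _≢_)
open import Relation.Nullary.Decidable using (does)
open import Data.Bool using (if_then_else_)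

-- A monomial ideal is represented by
-- the (upward-closed) set of monomials it contains; a monomial ideal is
-- determined by this set.  Coefficients (the field 𝕂) play no role.

Monomial : ℕ → Set
Monomial n = Vec ℕ n

_∣ᵐ_ : ∀ {n} → Monomial n → Monomial n → Set
u ∣ᵐ v = Pointwise _≤_ u v

MonIdeal : ℕ → Set₁
MonIdeal n = Monomial n → Set

Generated : ∀ {n} → (Monomial n → Set) → MonIdeal n
Generated G m = ∃[ g ] (G g × g ∣ᵐ m)

_≐_ : ∀ {n} → MonIdeal n → MonIdeal n → Set
J ≐ J' = ∀ m → (J m → J' m) × (J' m → J m)

MinGen : ∀ {n} → MonIdeal n → Monomial n → Set
MinGen J m = J m × (∀ m' → J m' → m' ∣ᵐ m → m' ≡ m)

-- lcm of a vector of monomials (lcm of the empty family is 1)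
lcmᵐ : ∀ {n j} → Vec (Monomial n) j → Monomial n
lcmᵐ {n} = foldr _ (zipWith _⊔_) (replicate n 0)

-- j-fold lcm-ideal: generated by lcms of j pairwise distinct minimal
-- generators of J (i.e. of subsets σ of the minimal generating set, |σ| = j)
LcmIdeal : ∀ {n} → MonIdeal n → ℕ → MonIdeal n
LcmIdeal {n} J j = Generated λ u →
  ∃[ gs ] (All (MinGen J) {j} gs × AllPairs _≢_ gs × lcmᵐ gs ≡ u)

-- The complete graph K_i on vertex set Fin i (≅ [i]).

-- edges {a,b}, encoded as pairs (a , b) with a < b
edges : (i : ℕ) → List (Fin i × Fin i)
edges i = concatMap (λ a → map (a ,_) (filter (λ b → a <? b) (allFin i))) (allFin i)

nE : ℕ → ℕ
nE i = length (edges i)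

-- a d-partition of [i], given by a surjective block-labelling Fin i → Fin d
-- (blocks A_c = c⁻¹(t); surjectivity = all d blocks nonempty)
Surjective : ∀ {i d} → (Fin i → Fin d) → Set
Surjective {i} {d} c = ∀ (t : Fin d) → ∃[ a ] (c a ≡ t)

-- m_C = ∏_{e ∈ E(C)} x_e : exponent 1 on edges joining different blocks
mC : ∀ {i d} → (Fin i → Fin d) → Monomial (nE i)
mC {i} c = tabulate λ e → f (Data.List.lookup (edges i) e)
  where
  f : Fin _ × Fin _ → ℕ
  f (a , b) = if does (c a ≟ c b) then 0 else 1

P : (i d : ℕ) → MonIdeal (nE i)
P i d = Generated λ u → ∃[ c ] (Surjective {i} {d} c × mC c ≡ u)

CutIdeal : (i : ℕ) → MonIdeal (nE i)
CutIdeal i = P i 2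

S : ℕ → ℕ → ℕ
S zero zero = 1
S zero (suc k) = 0
S (suc n) zero = 0
S (suc n) (suc k) = suc k * S n (suc k) + S n k

-- For labellings c, c' of the vertices, m_c' divides m_c exactly when c refines c'.  Two
-- partitions with the same number of blocks are comparable only if they coincide, so the minimal
-- generators of P_{i,d} are the m_C of the d-partitions C, which are listed by the recurrence
-- defining S(i,d).
--
-- After normalising so that block 0 lies on side 0, the 2-cuts coarser than a d-partition are
-- the nonzero vectors of 𝔽₂^(d-1).  Hence a (k+1)-partition C has 2^k - 1 distinct coarser cuts,
-- and the lcm of any j < 2^k of them divides m_C.  Conversely, j distinct cuts factor through
-- their common refinement; if it had d ≤ k blocks they would be j distinct nonzero vectors of
-- 𝔽₂^(d-1), impossible for j ≥ 2^(k-1).  So it has at least k+1 blocks, and merging blocks gives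
-- a (k+1)-partition whose monomial divides the lcm.

module Submission where

open import Defs
open import Data.Bool using (if_then_else_)
open import Data.Fin as Fin using (Fin; zero; suc; punchOut; finToFun; funToFin)
open import Data.Fin.Properties
  using (_≟_; <-cmp; any?; ¬∀⟶∃¬; injective⇒≤; cantor-schröder-bernstein; punchOut-injective;
         suc-injective; inject≤-injective; finToFun-funToFin; funToFin-finToFin;
         toℕ-injective; toℕ-fromℕ<; toℕ-inject≤; toℕ<n)
open import Data.List as List using (List; []; _∷_; [_]; _++_; map; length; allFin; concatMap)
open import Data.List.Properties using (length-++; length-map; length-tabulate)
open import Data.List.Relation.Unary.All as All using (All; []; _∷_)
open import Data.List.Relation.Unary.AllPairs as AllPairs using (AllPairs; []; _∷_)
import Data.List.Relation.Unary.AllPairs.Properties as AllPairs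
open import Data.List.Relation.Unary.Any as Any using (here)
open import Data.List.Relation.Unary.Unique.Propositional using (Unique)
open import Data.List.Relation.Unary.Unique.Propositional.Properties using (allFin⁺)
open import Data.List.Relation.Unary.Any.Properties using (lookup-index)
open import Data.List.Membership.Propositional using (_∈_; find)
open import Data.List.Membership.Propositional.Properties
  using (∈-allFin; ∈-map⁺; ∈-map⁻; ∈-filter⁺; ∈-concatMap⁺; ∈-concatMap⁻; ∈-++⁺ˡ; ∈-++⁺ʳ; ∈-++⁻)
open import Data.Nat as ℕ using (ℕ; zero; suc; _+_; _*_; _^_; _∸_; _≤_; _<_; _⊔_; z≤n; s≤s)
open import Data.Nat.Properties as ℕ using (≤-refl; ≤-trans; ≤-antisym; 1+n≰n)
open import Data.Product using (Σ-syntax; _×_; _,_; ∃-syntax; proj₁; proj₂)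
open import Data.Sum using (inj₁; inj₂)
open import Data.Vec using (Vec; []; _∷_; lookup; tabulate; zipWith)
open import Data.Vec.Properties
  using (lookup∘tabulate; tabulate∘lookup; tabulate-cong; lookup-replicate)
import Data.Vec.Relation.Unary.All.Properties as AllV
import Data.Vec.Relation.Unary.Unique.Propositional.Properties as UniqueV
open import Data.Vec.Relation.Binary.Pointwise.Inductive as Pointwise using ([]; _∷_)
open import Data.Vec.Relation.Binary.Pointwise.Extensional using (ext; extensional⇒inductive)
open import Function using (_∘_; id)
open import Relation.Binary.Definitions using (DecidableEquality; tri<; tri≈; tri>)
open import Relation.Binary.PropositionalEquality
  using (_≡_; _≢_; _≗_; refl; sym; trans; cong; cong₂; subst; subst₂; module ≡-Reasoning)
open import Relation.Nullary using (¬_; yes; no; does; contradiction)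

private variable
  i j m n d d' : ℕ

-- Monomials

∣ᵐ-refl : (u : Monomial n) → u ∣ᵐ u
∣ᵐ-refl u = Pointwise.refl ≤-refl

≡⇒∣ᵐ : {u v : Monomial n} → u ≡ v → u ∣ᵐ v
≡⇒∣ᵐ {u = u} refl = ∣ᵐ-refl u

∣ᵐ-trans : {u v w : Monomial n} → u ∣ᵐ v → v ∣ᵐ w → u ∣ᵐ w
∣ᵐ-trans = Pointwise.trans ≤-trans

∣ᵐ-antisym : {u v : Monomial n} → u ∣ᵐ v → v ∣ᵐ u → u ≡ v
∣ᵐ-antisym []       []       = refl
∣ᵐ-antisym (p ∷ ps) (q ∷ qs) = cong₂ _∷_ (≤-antisym p q) (∣ᵐ-antisym ps qs)

∣ᵐ-lookup : {u v : Monomial n} → u ∣ᵐ v → ∀ e → lookup u e ≤ lookup v e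
∣ᵐ-lookup = Pointwise.lookup

lookup⇒∣ᵐ : {u v : Monomial n} → (∀ e → lookup u e ≤ lookup v e) → u ∣ᵐ v
lookup⇒∣ᵐ le = extensional⇒inductive (ext le)

⊔ᵐ-upperˡ : (u v : Monomial n) → u ∣ᵐ zipWith _⊔_ u v
⊔ᵐ-upperˡ []      []      = []
⊔ᵐ-upperˡ (x ∷ u) (y ∷ v) = ℕ.m≤m⊔n x y ∷ ⊔ᵐ-upperˡ u v

⊔ᵐ-upperʳ : (u v : Monomial n) → v ∣ᵐ zipWith _⊔_ u v
⊔ᵐ-upperʳ []      []      = []
⊔ᵐ-upperʳ (x ∷ u) (y ∷ v) = ℕ.m≤n⊔m x y ∷ ⊔ᵐ-upperʳ u v

⊔ᵐ-least : {u v w : Monomial n} → u ∣ᵐ w → v ∣ᵐ w → zipWith _⊔_ u v ∣ᵐ w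
⊔ᵐ-least []       []       = []
⊔ᵐ-least (p ∷ ps) (q ∷ qs) = ℕ.⊔-lub p q ∷ ⊔ᵐ-least ps qs

lcmᵐ-upper : (gs : Vec (Monomial n) j) (t : Fin j) → lookup gs t ∣ᵐ lcmᵐ gs
lcmᵐ-upper (g ∷ gs) zero    = ⊔ᵐ-upperˡ g (lcmᵐ gs)
lcmᵐ-upper (g ∷ gs) (suc t) = ∣ᵐ-trans (lcmᵐ-upper gs t) (⊔ᵐ-upperʳ g (lcmᵐ gs))

lcmᵐ-least : (gs : Vec (Monomial n) j) {w : Monomial n} →
             (∀ t → lookup gs t ∣ᵐ w) → lcmᵐ gs ∣ᵐ w
lcmᵐ-least []       {w} _ = lookup⇒∣ᵐ λ e → subst (_≤ lookup w e) (sym (lookup-replicate e 0)) z≤n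
lcmᵐ-least (g ∷ gs) gs∣w = ⊔ᵐ-least (gs∣w zero) (lcmᵐ-least gs (gs∣w ∘ suc))

Generated-∣ᵐ : {G : Monomial n → Set} {u v : Monomial n} →
               Generated G u → u ∣ᵐ v → Generated G v
Generated-∣ᵐ (g , Gg , g∣u) u∣v = g , Gg , ∣ᵐ-trans g∣u u∣v

MinGen-Generated : {G : Monomial n → Set} {u : Monomial n} → MinGen (Generated G) u → G u
MinGen-Generated ((g , Gg , g∣u) , minimal) = subst _ (minimal g (g , Gg , ∣ᵐ-refl g) g∣u) Gg

-- Kernels of labellings

Refines : {A B : Set} → (Fin i → A) → (Fin i → B) → Set
Refines {i} c c' = (a b : Fin i) → c a ≡ c b → c' a ≡ c' b

SameKernel : {A B : Set} → (Fin i → A) → (Fin i → B) → Set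
SameKernel c c' = Refines c c' × Refines c' c

Refines-cons : {A B : Set} {c : Fin (suc n) → A} {c' : Fin (suc n) → B} →
               Refines (c ∘ suc) (c' ∘ suc) → (∀ b → c zero ≡ c (suc b) → c' zero ≡ c' (suc b)) →
               Refines c c'
Refines-cons _     _     zero    zero    _  = refl
Refines-cons _     head⊑ zero    (suc b) eq = head⊑ b eq
Refines-cons _     head⊑ (suc a) zero    eq = sym (head⊑ a (sym eq))
Refines-cons tail⊑ _     (suc a) (suc b) eq = tail⊑ a b eq

Refines-∘⁻ : {A B : Set} {c : Fin i → Fin d} {f : Fin d → A} {g : Fin d → B} →
             Surjective c → Refines (f ∘ c) (g ∘ c) → Refines f g
Refines-∘⁻ c-surj fc⊑gc x y eq with c-surj x | c-surj y
... | a , refl | b , refl = fc⊑gc a b eq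

injective⇒surjective : (f : Fin n → Fin n) → (∀ {x y} → f x ≡ f y → x ≡ y) → Surjective f
injective⇒surjective {suc n} f f-injective z with any? (λ t → f t ≟ z)
... | yes hit = hit
... | no miss =
  contradiction (injective⇒≤ (f-injective ∘ punchOut-injective (missed _) (missed _))) 1+n≰n
  where
  missed : ∀ t → z ≢ f t
  missed t eq = miss (t , sym eq)

relabel-injective : {c : Fin n → Fin d} {c' : Fin n → Fin d'} (c-surj : Surjective c) →
                    Refines c' c →
                    ∀ {t t'} → c' (proj₁ (c-surj t)) ≡ c' (proj₁ (c-surj t')) → t ≡ t'
relabel-injective c-surj c'⊑c {t} {t'} eq =
  trans (sym (proj₂ (c-surj t))) (trans (c'⊑c _ _ eq) (proj₂ (c-surj t')))

SameKernel-surjective⇒≡ : {c : Fin n → Fin d} {c' : Fin n → Fin d'} → Surjective c → Surjective c' →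
                          SameKernel c c' → d ≡ d'
SameKernel-surjective⇒≡ c-surj c'-surj (c⊑c' , c'⊑c) =
  cantor-schröder-bernstein (relabel-injective c-surj c'⊑c) (relabel-injective c'-surj c⊑c')

surjective-Refines⇒SameKernel : {c c' : Fin i → Fin d} → Surjective c → Surjective c' →
                                Refines c c' → SameKernel c c'
surjective-Refines⇒SameKernel {d = d} {c = c} {c'} c-surj c'-surj c⊑c' = c⊑c' , c'⊑c
  where
  ψ : Fin d → Fin d
  ψ s = c (proj₁ (c'-surj s))
  ψ-surj : Surjective ψ
  ψ-surj = injective⇒surjective ψ (relabel-injective c'-surj c⊑c')
  label : ∀ a → proj₁ (ψ-surj (c a)) ≡ c' a
  label a = trans (sym (proj₂ (c'-surj _))) (c⊑c' _ a (proj₂ (ψ-surj (c a))))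
  c'⊑c : Refines c' c
  c'⊑c a b eq = begin
    c a                       ≡⟨ proj₂ (ψ-surj (c a)) ⟨
    ψ (proj₁ (ψ-surj (c a)))  ≡⟨ cong ψ (trans (label a) (trans eq (sym (label b)))) ⟩
    ψ (proj₁ (ψ-surj (c b)))  ≡⟨ proj₂ (ψ-surj (c b)) ⟩
    c b                       ∎
    where open ≡-Reasoning

squash : (m : ℕ) → Fin d → Fin (suc m)
squash m s with Fin.toℕ s ℕ.<? suc m
... | yes s<1+m = Fin.fromℕ< s<1+m
... | no _      = zero

squash-surjective : {m : ℕ} → suc m ≤ d → Surjective (squash {d} m)
squash-surjective {m = m} 1+m≤d t = Fin.inject≤ t 1+m≤d , squash-inject≤
  where
  squash-inject≤ : squash m (Fin.inject≤ t 1+m≤d) ≡ t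
  squash-inject≤ with Fin.toℕ (Fin.inject≤ t 1+m≤d) ℕ.<? suc m
  ... | yes lt = toℕ-injective (trans (toℕ-fromℕ< lt) (toℕ-inject≤ t 1+m≤d))
  ... | no ¬lt = contradiction (subst (ℕ._< suc m) (sym (toℕ-inject≤ t 1+m≤d)) (toℕ<n t)) ¬lt

-- Cut monomials

edge : Fin (nE i) → Fin i × Fin i
edge {i} = List.lookup (edges i)

edge-index : {a b : Fin i} → a Fin.< b → ∃[ e ] edge e ≡ (a , b)
edge-index {i} {a} {b} a<b = Any.index a,b∈ , sym (lookup-index a,b∈)
  where
  a,b∈ : (a , b) ∈ edges i
  a,b∈ = ∈-concatMap⁺ _
    (Any.map (λ { refl → ∈-map⁺ (a ,_) (∈-filter⁺ (a Fin.<?_) (∈-allFin b) a<b) }) (∈-allFin a))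

Separates : (Fin i → Fin d) → Fin i × Fin i → Set
Separates c (a , b) = c a ≢ c b

mC-lookup : (c : Fin i → Fin d) (e : Fin (nE i)) →
            lookup (mC c) e ≡ (if does (c (proj₁ (edge e)) ≟ c (proj₂ (edge e))) then 0 else 1)
mC-lookup c e = lookup∘tabulate _ e

mC-separated : (c : Fin i → Fin d) (e : Fin (nE i)) → Separates c (edge e) → lookup (mC c) e ≡ 1
mC-separated c e sep with c (proj₁ (edge e)) ≟ c (proj₂ (edge e)) | mC-lookup c e
... | yes joined | _  = contradiction joined sep
... | no _       | eq = eq

mC-joined : (c : Fin i → Fin d) (e : Fin (nE i)) → ¬ Separates c (edge e) → lookup (mC c) e ≡ 0
mC-joined c e ¬sep with c (proj₁ (edge e)) ≟ c (proj₂ (edge e)) | mC-lookup c e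
... | yes _   | eq = eq
... | no sep  | _  = contradiction sep ¬sep

mC-∣ᵐ : (c : Fin i → Fin d) {u : Monomial (nE i)} →
        (∀ e → Separates c (edge e) → 1 ≤ lookup u e) → mC c ∣ᵐ u
mC-∣ᵐ c {u} separated⇒1≤ = lookup⇒∣ᵐ bound
  where
  bound : ∀ e → lookup (mC c) e ≤ lookup u e
  bound e with c (proj₁ (edge e)) ≟ c (proj₂ (edge e))
  ... | yes joined = subst (_≤ lookup u e) (sym (mC-joined c e (contradiction joined))) z≤n
  ... | no sep     = subst (_≤ lookup u e) (sym (mC-separated c e sep)) (separated⇒1≤ e sep)

Refines⇒mC-∣ᵐ : {c : Fin i → Fin d} {c' : Fin i → Fin d'} → Refines c c' → mC c' ∣ᵐ mC c
Refines⇒mC-∣ᵐ {c = c} {c'} c⊑c' =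
  mC-∣ᵐ c' λ e sep → ℕ.≤-reflexive (sym (mC-separated c e (sep ∘ c⊑c' _ _)))

mC-∣ᵐ⇒joins< : {c : Fin i → Fin d} {c' : Fin i → Fin d'} → mC c ∣ᵐ mC c' →
                {a b : Fin i} → a Fin.< b → c' a ≡ c' b → c a ≡ c b
mC-∣ᵐ⇒joins< {c = c} {c'} c∣c' {a} {b} a<b eq with c a ≟ c b | edge-index a<b
... | yes eq' | _ = eq'
... | no sep | e , refl = contradiction
  (subst₂ _≤_ (mC-separated c e sep) (mC-joined c' e (λ sep' → sep' eq)) (∣ᵐ-lookup c∣c' e))
  λ ()

mC-∣ᵐ⇒Refines : {c : Fin i → Fin d} {c' : Fin i → Fin d'} → mC c ∣ᵐ mC c' → Refines c' c
mC-∣ᵐ⇒Refines c∣c' a b eq with <-cmp a b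
... | tri< a<b _ _ = mC-∣ᵐ⇒joins< c∣c' a<b eq
... | tri≈ _ refl _ = refl
... | tri> _ _ b<a = sym (mC-∣ᵐ⇒joins< c∣c' b<a (sym eq))

SameKernel⇒mC-≡ : {c : Fin i → Fin d} {c' : Fin i → Fin d'} → SameKernel c c' → mC c ≡ mC c'
SameKernel⇒mC-≡ (c⊑c' , c'⊑c) = ∣ᵐ-antisym (Refines⇒mC-∣ᵐ c'⊑c) (Refines⇒mC-∣ᵐ c⊑c')

mC-≡⇒SameKernel : {c : Fin i → Fin d} {c' : Fin i → Fin d'} → mC c ≡ mC c' → SameKernel c c'
mC-≡⇒SameKernel eq = mC-∣ᵐ⇒Refines (≡⇒∣ᵐ (sym eq)) , mC-∣ᵐ⇒Refines (≡⇒∣ᵐ eq)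

mC-MinGen : {c : Fin i → Fin d} → Surjective c → MinGen (P i d) (mC c)
mC-MinGen {i = i} {d = d} {c = c} c-surj = (mC c , (c , c-surj , refl) , ∣ᵐ-refl (mC c)) , minimal
  where
  minimal : ∀ u → P i d u → u ∣ᵐ mC c → u ≡ mC c
  minimal u (_ , (c' , c'-surj , refl) , c'∣u) u∣c =
    ∣ᵐ-antisym u∣c (∣ᵐ-trans (Refines⇒mC-∣ᵐ c'⊑c) c'∣u)
    where
    c'⊑c : Refines c' c
    c'⊑c = proj₂ (surjective-Refines⇒SameKernel c-surj c'-surj
                   (mC-∣ᵐ⇒Refines (∣ᵐ-trans c'∣u u∣c)))

P-coarsen : {m : ℕ} {u : Monomial (nE i)} → suc m ≤ d → P i d u → P i (suc m) u
P-coarsen {m = m} 1+m≤d (_ , (c , c-surj , refl) , c∣u) =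
  mC (squash m ∘ c) , (squash m ∘ c , surjective , refl) ,
  ∣ᵐ-trans (Refines⇒mC-∣ᵐ {c = c} (λ a b → cong (squash m))) c∣u
  where
  surjective : Surjective (squash m ∘ c)
  surjective t with squash-surjective 1+m≤d t
  ... | s , refl with c-surj s
  ... | a , refl = a , refl

-- Set partitions

joinBlock : (Fin n → Fin d) → Fin d → Fin (suc n) → Fin d
joinBlock p t zero    = t
joinBlock p t (suc v) = p v

newBlock : (Fin n → Fin d) → Fin (suc n) → Fin (suc d)
newBlock p zero    = zero
newBlock p (suc v) = suc (p v)

joinEachBlock : List (Fin n → Fin d) → List (Fin (suc n) → Fin d)
joinEachBlock {d = d} = concatMap (λ p → map (joinBlock p) (allFin d))

partitions : (n d : ℕ) → List (Fin n → Fin d)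
partitions zero    zero    = [ (λ ()) ]
partitions zero    (suc d) = []
partitions (suc n) zero    = []
partitions (suc n) (suc d) = joinEachBlock (partitions n (suc d)) ++ map newBlock (partitions n d)

length-joinEachBlock : (ps : List (Fin n → Fin d)) → length (joinEachBlock ps) ≡ d * length ps
length-joinEachBlock {d = d} []       = sym (ℕ.*-zeroʳ d)
length-joinEachBlock {d = d} (p ∷ ps) = begin
  length (map (joinBlock p) (allFin d) ++ joinEachBlock ps)
    ≡⟨ length-++ (map (joinBlock p) (allFin d)) ⟩
  length (map (joinBlock p) (allFin d)) + length (joinEachBlock ps)
    ≡⟨ cong₂ _+_ (trans (length-map _ (allFin d)) (length-tabulate id)) (length-joinEachBlock ps) ⟩
  d + d * length ps
    ≡⟨ ℕ.*-suc d (length ps) ⟨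
  d * suc (length ps) ∎
  where open ≡-Reasoning

length-partitions : (n d : ℕ) → length (partitions n d) ≡ S n d
length-partitions zero    zero    = refl
length-partitions zero    (suc d) = refl
length-partitions (suc n) zero    = refl
length-partitions (suc n) (suc d) = begin
  length (joinEachBlock (partitions n (suc d)) ++ map newBlock (partitions n d))
    ≡⟨ length-++ (joinEachBlock (partitions n (suc d))) ⟩
  length (joinEachBlock (partitions n (suc d))) + length (map newBlock (partitions n d))
    ≡⟨ cong₂ _+_ (length-joinEachBlock (partitions n (suc d)))
                 (length-map newBlock (partitions n d)) ⟩
  suc d * length (partitions n (suc d)) + length (partitions n d)
    ≡⟨ cong₂ (λ x y → suc d * x + y) (length-partitions n (suc d)) (length-partitions n d) ⟩
  S (suc n) (suc d) ∎
  where open ≡-Reasoning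

∈-joinEachBlock⁺ : {ps : List (Fin n → Fin d)} {p : Fin n → Fin d} (t : Fin d) →
                   p ∈ ps → joinBlock p t ∈ joinEachBlock ps
∈-joinEachBlock⁺ t p∈ = ∈-concatMap⁺ _ (Any.map (λ { refl → ∈-map⁺ _ (∈-allFin t) }) p∈)

∈-joinEachBlock⁻ : (ps : List (Fin n → Fin d)) {q : Fin (suc n) → Fin d} →
                   q ∈ joinEachBlock ps → ∃[ p ] ∃[ t ] (p ∈ ps × q ≡ joinBlock p t)
∈-joinEachBlock⁻ {d = d} ps q∈ with find (∈-concatMap⁻ (λ p → map (joinBlock p) (allFin d)) {ps} q∈)
... | p , p∈ , q∈′ with ∈-map⁻ (joinBlock p) q∈′
... | t , _ , refl = p , t , p∈ , refl

joinBlock-surjective : {p : Fin n → Fin d} → Surjective p → ∀ t → Surjective (joinBlock p t)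
joinBlock-surjective p-surj t s = let v , pv≡s = p-surj s in suc v , pv≡s

newBlock-surjective : {p : Fin n → Fin d} → Surjective p → Surjective (newBlock p)
newBlock-surjective p-surj zero    = zero , refl
newBlock-surjective p-surj (suc s) = let v , pv≡s = p-surj s in suc v , cong suc pv≡s

partitions-surjective : (n d : ℕ) {p : Fin n → Fin d} → p ∈ partitions n d → Surjective p
partitions-surjective zero    zero    (here refl) ()
partitions-surjective (suc n) (suc d) q∈ with ∈-++⁻ (joinEachBlock (partitions n (suc d))) q∈
... | inj₁ q∈ˡ with ∈-joinEachBlock⁻ (partitions n (suc d)) q∈ˡ
...   | p , t , p∈ , refl = joinBlock-surjective (partitions-surjective n (suc d) p∈) t
partitions-surjective (suc n) (suc d) q∈ | inj₂ q∈ʳ with ∈-map⁻ newBlock q∈ʳ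
... | p , p∈ , refl = newBlock-surjective (partitions-surjective n d p∈)

coimage : {A : Set} → DecidableEquality A → (f : Fin n → A) →
          ∃[ d ] ∃[ q ] (q ∈ partitions n d × SameKernel q f)
coimage {zero}  _≟ᴬ_ f = 0 , (λ ()) , here refl , (λ ()) , (λ ())
coimage {suc n} _≟ᴬ_ f with coimage _≟ᴬ_ (f ∘ suc) | any? (λ v → f (suc v) ≟ᴬ f zero)
... | zero , q , _ , _ | yes (v , _) with () ← q v
... | suc d , q , q∈ , q⊑f , f⊑q | yes (v , f₁v≡f₀) =
  suc d , joinBlock q (q v) , ∈-++⁺ˡ (∈-joinEachBlock⁺ (q v) q∈) ,
  Refines-cons q⊑f (λ b eq → trans (sym f₁v≡f₀) (q⊑f v b eq)) ,
  Refines-cons f⊑q (λ b eq → f⊑q v b (trans f₁v≡f₀ eq))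
... | d , q , q∈ , q⊑f , f⊑q | no f₀∉ =
  suc d , newBlock q , ∈-++⁺ʳ (joinEachBlock (partitions n (suc d))) (∈-map⁺ newBlock q∈) ,
  Refines-cons (λ a b eq → q⊑f a b (suc-injective eq)) (λ b ()) ,
  Refines-cons (λ a b eq → cong suc (f⊑q a b eq)) (λ b eq → contradiction (b , sym eq) f₀∉)

DistinctKernels : (Fin n → Fin d) → (Fin n → Fin d) → Set
DistinctKernels p q = ¬ SameKernel p q

joinBlock-distinct : {p : Fin n → Fin d} → Surjective p → ∀ {t t'} → t ≢ t' →
                     DistinctKernels (joinBlock p t) (joinBlock p t')
joinBlock-distinct p-surj {t} t≢t' (same , _) =
  let v , pv≡t = p-surj t in t≢t' (trans (sym pv≡t) (sym (same zero (suc v) (sym pv≡t))))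

joinBlock-newBlock-distinct : {p : Fin n → Fin (suc d)} {q : Fin n → Fin d} → Surjective p →
                              ∀ t → DistinctKernels (joinBlock p t) (newBlock q)
joinBlock-newBlock-distinct p-surj t (same , _) with v , pv≡t ← p-surj t
  with () ← same zero (suc v) (sym pv≡t)

joinBlock-SameKernel⁻ : {p q : Fin n → Fin d} {t s : Fin d} →
                        SameKernel (joinBlock p t) (joinBlock q s) → SameKernel p q
joinBlock-SameKernel⁻ (same , same') =
  (λ a b → same (suc a) (suc b)) , (λ a b → same' (suc a) (suc b))

newBlock-SameKernel⁻ : {p q : Fin n → Fin d} → SameKernel (newBlock p) (newBlock q) → SameKernel p q
newBlock-SameKernel⁻ (same , same') =
  (λ a b eq → suc-injective (same (suc a) (suc b) (cong suc eq))) ,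
  (λ a b eq → suc-injective (same' (suc a) (suc b) (cong suc eq)))

joinEachBlock-distinct : {ps : List (Fin n → Fin d)} → All Surjective ps →
                         AllPairs DistinctKernels ps → AllPairs DistinctKernels (joinEachBlock ps)
joinEachBlock-distinct {ps = []} [] [] = []
joinEachBlock-distinct {d = d} {ps = p ∷ ps} (p-surj ∷ ps-surj) (p∉ ∷ ps!) =
  AllPairs.++⁺ (AllPairs.map⁺ (AllPairs.map (joinBlock-distinct p-surj) (allFin⁺ d)))
               (joinEachBlock-distinct ps-surj ps!)
               (All.tabulate λ x∈ → All.tabulate λ y∈ → across x∈ y∈)
  where
  across : ∀ {x y} → x ∈ map (joinBlock p) (allFin d) → y ∈ joinEachBlock ps → DistinctKernels x y
  across x∈ y∈ with ∈-map⁻ (joinBlock p) x∈ | ∈-joinEachBlock⁻ ps y∈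
  ... | t , _ , refl | q , s , q∈ , refl = All.lookup p∉ q∈ ∘ joinBlock-SameKernel⁻

partitions-distinct : (n d : ℕ) → AllPairs DistinctKernels (partitions n d)
partitions-distinct zero    zero    = [] ∷ []
partitions-distinct zero    (suc d) = []
partitions-distinct (suc n) zero    = []
partitions-distinct (suc n) (suc d) =
  AllPairs.++⁺ (joinEachBlock-distinct (All.tabulate (partitions-surjective n (suc d)))
                                       (partitions-distinct n (suc d)))
               (AllPairs.map⁺ (AllPairs.map (_∘ newBlock-SameKernel⁻) (partitions-distinct n d)))
               (All.tabulate λ x∈ → All.tabulate λ y∈ → across x∈ y∈)
  where
  across : ∀ {x y} → x ∈ joinEachBlock (partitions n (suc d)) → y ∈ map newBlock (partitions n d) →
           DistinctKernels x y
  across x∈ y∈ with ∈-joinEachBlock⁻ (partitions n (suc d)) x∈ | ∈-map⁻ newBlock y∈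
  ... | p , t , p∈ , refl | q , _ , refl =
    joinBlock-newBlock-distinct (partitions-surjective n (suc d) p∈) t

minimalGenerators : (i d : ℕ) →
  ∃[ L ] (Unique L × length L ≡ S i d ×
          (∀ m → (m ∈ L → MinGen (P i d) m) × (MinGen (P i d) m → m ∈ L)))
minimalGenerators i d =
  map mC (partitions i d) ,
  AllPairs.map⁺ (AllPairs.map (_∘ mC-≡⇒SameKernel) (partitions-distinct i d)) ,
  trans (length-map mC (partitions i d)) (length-partitions i d) ,
  λ m → minimal m , listed m
  where
  minimal : ∀ m → m ∈ map mC (partitions i d) → MinGen (P i d) m
  minimal m m∈ with ∈-map⁻ mC m∈
  ... | p , p∈ , refl = mC-MinGen (partitions-surjective i d p∈)
  listed : ∀ m → MinGen (P i d) m → m ∈ map mC (partitions i d)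
  listed m m-min with c , c-surj , refl ← MinGen-Generated m-min
    with d' , p , p∈ , p≈c ← coimage _≟_ c
    with refl ← SameKernel-surjective⇒≡ (partitions-surjective i d' p∈) c-surj p≈c =
    subst (_∈ map mC (partitions i d)) (SameKernel⇒mC-≡ p≈c) (∈-map⁺ mC p∈)

-- Nonzero vectors of 𝔽₂^m

_⊕_ : Fin 2 → Fin 2 → Fin 2
zero     ⊕ y        = y
suc zero ⊕ zero     = suc zero
suc zero ⊕ suc zero = zero

⊕-self : (x : Fin 2) → x ⊕ x ≡ zero
⊕-self zero       = refl
⊕-self (suc zero) = refl

⊕-cancelʳ : (x y z : Fin 2) → x ⊕ z ≡ y ⊕ z → x ≡ y
⊕-cancelʳ zero       zero       _          _  = refl
⊕-cancelʳ (suc zero) (suc zero) _          _  = refl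
⊕-cancelʳ zero       (suc zero) zero       ()
⊕-cancelʳ zero       (suc zero) (suc zero) ()
⊕-cancelʳ (suc zero) zero       zero       ()
⊕-cancelʳ (suc zero) zero       (suc zero) ()

⊕≡0⇒≡ : (x y : Fin 2) → x ⊕ y ≡ zero → x ≡ y
⊕≡0⇒≡ x y eq = ⊕-cancelʳ x y y (trans eq (sym (⊕-self y)))

Fin2-≢⇒≡ : {x y z : Fin 2} → x ≢ z → y ≢ z → x ≡ y
Fin2-≢⇒≡ {zero}     {zero}     _   _   = refl
Fin2-≢⇒≡ {suc zero} {suc zero} _   _   = refl
Fin2-≢⇒≡ {zero}     {suc zero} {zero}     x≢z _   = contradiction refl x≢z
Fin2-≢⇒≡ {zero}     {suc zero} {suc zero} _   y≢z = contradiction refl y≢z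
Fin2-≢⇒≡ {suc zero} {zero}     {zero}     _   y≢z = contradiction refl y≢z
Fin2-≢⇒≡ {suc zero} {zero}     {suc zero} x≢z _   = contradiction refl x≢z

funToFin-cong : {f g : Fin m → Fin n} → f ≗ g → funToFin f ≡ funToFin g
funToFin-cong {zero}  _   = refl
funToFin-cong {suc m} f≗g = cong₂ Fin.combine (f≗g zero) (funToFin-cong (f≗g ∘ suc))

funToFin-injective : {f g : Fin m → Fin n} → funToFin f ≡ funToFin g → f ≗ g
funToFin-injective {f = f} {g} eq s =
  trans (sym (finToFun-funToFin f s)) (trans (cong (λ x → finToFun x s) eq) (finToFun-funToFin g s))

record NonzeroCodes (j m : ℕ) : Set where
  field
    code           : Fin j → Fin m → Fin 2
    code-injective : ∀ {t t'} → code t ≗ code t' → t ≡ t'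
    code-nonzero   : ∀ t → ¬ (∀ s → code t s ≡ zero)

nonzeroCodes-bound : NonzeroCodes j m → j < 2 ^ m
nonzeroCodes-bound {j} {m} C = injective⇒≤ encode-injective
  where
  open NonzeroCodes C
  encode : Fin (suc j) → Fin (2 ^ m)
  encode zero    = funToFin {m} {2} (λ _ → zero)
  encode (suc t) = funToFin (code t)
  encode-injective : ∀ {t t'} → encode t ≡ encode t' → t ≡ t'
  encode-injective {zero}  {zero}   _  = refl
  encode-injective {zero}  {suc t'} eq =
    contradiction (sym ∘ funToFin-injective eq) (code-nonzero t')
  encode-injective {suc t} {zero}   eq = contradiction (funToFin-injective eq) (code-nonzero t)
  encode-injective {suc t} {suc t'} eq = cong suc (code-injective (funToFin-injective eq))

nonzeroCodes : j < 2 ^ m → NonzeroCodes j m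
nonzeroCodes {j} {m} j<2^m = record
  { code           = λ t s → enum (suc t) s ⊕ enum zero s
  ; code-injective = λ eq → suc-injective (enum-injective λ s → ⊕-cancelʳ _ _ _ (eq s))
  ; code-nonzero   = λ t eq → contradiction (enum-injective λ s → ⊕≡0⇒≡ _ _ (eq s)) λ ()
  }
  where
  enum : Fin (suc j) → Fin m → Fin 2
  enum t = finToFun (Fin.inject≤ t j<2^m)
  enum-injective : ∀ {t t'} → enum t ≗ enum t' → t ≡ t'
  enum-injective {t} {t'} eq = inject≤-injective j<2^m j<2^m t t' (begin
    Fin.inject≤ t j<2^m                      ≡⟨ funToFin-finToFin {m} {2} _ ⟨
    funToFin (enum t)                        ≡⟨ funToFin-cong eq ⟩
    funToFin (enum t')                       ≡⟨ funToFin-finToFin {m} {2} _ ⟩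
    Fin.inject≤ t' j<2^m                     ∎)
    where open ≡-Reasoning

-- Families of distinct cuts

SameKernel-Fin2 : {c c' : Fin n → Fin 2} → SameKernel c c' → ∀ {a} → c a ≡ c' a → c ≗ c'
SameKernel-Fin2 {c = c} {c'} (c⊑c' , c'⊑c) {a} agree v with c v ≟ c a
... | yes joined = trans joined (trans agree (sym (c⊑c' v a joined)))
... | no apart   = Fin2-≢⇒≡ apart (λ eq → apart (c'⊑c v a (trans eq agree)))

record CutFamily (i j : ℕ) : Set where
  field
    cut            : Fin j → Fin i → Fin 2
    cut-surjective : ∀ t → Surjective (cut t)
    cut-injective  : ∀ {t t'} → SameKernel (cut t) (cut t') → t ≡ t'

open CutFamily

codes⇒cutFamily : NonzeroCodes j d → CutFamily (suc d) j
codes⇒cutFamily {j = j} {d = d} C = record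
  { cut            = cut′
  ; cut-surjective = surjective
  ; cut-injective  = λ same → code-injective (SameKernel-Fin2 same {zero} refl ∘ suc)
  }
  where
  open NonzeroCodes C
  cut′ : Fin j → Fin (suc d) → Fin 2
  cut′ t zero    = zero
  cut′ t (suc s) = code t s
  surjective : ∀ t → Surjective (cut′ t)
  surjective t zero       = zero , refl
  surjective t (suc zero) =
    let s , s≢0 = ¬∀⟶∃¬ d _ (λ s → code t s ≟ zero) (code-nonzero t) in suc s , Fin2-≢⇒≡ s≢0 λ ()

cutFamily⇒codes : CutFamily (suc d) j → NonzeroCodes j d
cutFamily⇒codes {d = d} {j = j} F = record
  { code           = λ t s → normal t (suc s)
  ; code-injective = λ same → cut-injective F (refines same , refines (sym ∘ same))
  ; code-nonzero   = λ t zero-code → constant-not-surjective t λ where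
      zero    → refl
      (suc s) → ⊕≡0⇒≡ _ _ (zero-code s)
  }
  where
  normal : Fin j → Fin (suc d) → Fin 2
  normal t v = cut F t v ⊕ cut F t zero
  refines : ∀ {t t'} → (∀ s → normal t (suc s) ≡ normal t' (suc s)) → Refines (cut F t) (cut F t')
  refines {t} {t'} same a b eq = ⊕-cancelʳ _ _ (cut F t' zero)
    (trans (sym (normal≗ a)) (trans (cong (_⊕ cut F t zero) eq) (normal≗ b)))
    where
    normal≗ : ∀ v → normal t v ≡ normal t' v
    normal≗ zero    = trans (⊕-self (cut F t zero)) (sym (⊕-self (cut F t' zero)))
    normal≗ (suc s) = same s
  constant-not-surjective : ∀ t → ¬ (∀ v → cut F t v ≡ cut F t zero)
  constant-not-surjective t constant =
    let a₀ , a₀↦0 = cut-surjective F t zero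
        a₁ , a₁↦1 = cut-surjective F t (suc zero)
    in contradiction (trans (sym a₀↦0) (trans (constant a₀) (trans (sym (constant a₁)) a₁↦1))) λ ()

cutFamily-bound : CutFamily d j → j < 2 ^ (d ∸ 1)
cutFamily-bound {zero}  {zero}  F = s≤s z≤n
cutFamily-bound {zero}  {suc j} F with () ← proj₁ (cut-surjective F zero zero)
cutFamily-bound {suc d}         F = nonzeroCodes-bound (cutFamily⇒codes F)

pullback : (c : Fin i → Fin d) → Surjective c → CutFamily d j → CutFamily i j
pullback c c-surj F = record
  { cut            = λ t → cut F t ∘ c
  ; cut-surjective = λ t x →
      let s , s↦x = cut-surjective F t x
          a , a↦s = c-surj s
      in a , trans (cong (cut F t) a↦s) s↦x
  ; cut-injective  = λ (same , same') →
      cut-injective F (Refines-∘⁻ c-surj same , Refines-∘⁻ c-surj same')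
  }

pushforward : (F : CutFamily i j) (q : Fin i → Fin d) → Surjective q →
              (∀ t → Refines q (cut F t)) → CutFamily d j
pushforward {j = j} {d = d} F q q-surj q⊑cut = record
  { cut            = cut′
  ; cut-surjective = λ t x → let a , a↦x = cut-surjective F t x in q a , trans (factor t a) a↦x
  ; cut-injective  = λ (same , same') → cut-injective F (transfer same , transfer same')
  }
  where
  cut′ : Fin j → Fin d → Fin 2
  cut′ t s = cut F t (proj₁ (q-surj s))
  factor : ∀ t a → cut′ t (q a) ≡ cut F t a
  factor t a = q⊑cut t _ a (proj₂ (q-surj (q a)))
  transfer : ∀ {t t'} → Refines (cut′ t) (cut′ t') → Refines (cut F t) (cut F t')
  transfer {t} {t'} r a b eq = begin
    cut F t' a      ≡⟨ factor t' a ⟨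
    cut′ t' (q a)   ≡⟨ r (q a) (q b) (trans (factor t a) (trans eq (sym (factor t b)))) ⟩
    cut′ t' (q b)   ≡⟨ factor t' b ⟩
    cut F t' b      ∎
    where open ≡-Reasoning

commonRefinement : (F : CutFamily i j) →
  ∃[ d ] Σ[ q ∈ (Fin i → Fin d) ]
    (Surjective q × (∀ t → Refines q (cut F t)) ×
     (∀ a b → (∀ t → cut F t a ≡ cut F t b) → q a ≡ q b))
-- A vertex is compared with others through its side in every cut, encoded in Fin (2 ^ j)
-- so that it has decidable equality.
commonRefinement F with coimage _≟_ (λ a → funToFin (λ t → cut F t a))
... | d , q , q∈ , q⊑profile , profile⊑q =
  d , q , partitions-surjective _ d q∈ , (λ t a b eq → funToFin-injective (q⊑profile a b eq) t) ,
  (λ a b agree → profile⊑q a b (funToFin-cong agree))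

lcmᶠ : CutFamily i j → Monomial (nE i)
lcmᶠ F = lcmᵐ (tabulate (mC ∘ cut F))

mC-∣ᵐ-lcmᶠ : (F : CutFamily i j) (c : Fin i → Fin d) →
             (∀ p → Separates c p → ∃[ t ] Separates (cut F t) p) → mC c ∣ᵐ lcmᶠ F
mC-∣ᵐ-lcmᶠ F c separated = mC-∣ᵐ c λ e sep →
  let t , sepₜ = separated (edge e) sep in
  subst (_≤ lookup (lcmᶠ F) e) (mC-separated (cut F t) e sepₜ)
    (∣ᵐ-lookup (subst (_∣ᵐ lcmᶠ F) (lookup∘tabulate _ t) (lcmᵐ-upper (tabulate (mC ∘ cut F)) t)) e)

lcmᶠ-∣ᵐ-mC : (F : CutFamily i j) (c : Fin i → Fin d) → (∀ t → Refines c (cut F t)) → lcmᶠ F ∣ᵐ mC c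
lcmᶠ-∣ᵐ-mC F c c⊑cut = lcmᵐ-least (tabulate (mC ∘ cut F)) λ t →
  subst (_∣ᵐ mC c) (sym (lookup∘tabulate _ t)) (Refines⇒mC-∣ᵐ {c = c} (c⊑cut t))

lcmᶠ∈LcmIdeal : (F : CutFamily i j) → LcmIdeal (CutIdeal i) j (lcmᶠ F)
lcmᶠ∈LcmIdeal F =
  lcmᶠ F ,
  (tabulate (mC ∘ cut F) ,
   AllV.tabulate⁺ (λ t → mC-MinGen (cut-surjective F t)) ,
   UniqueV.tabulate⁺ (cut-injective F ∘ mC-≡⇒SameKernel) ,
   refl) ,
  ∣ᵐ-refl (lcmᶠ F)

LcmIdeal⇒cutFamily : {u : Monomial (nE i)} → LcmIdeal (CutIdeal i) j u → ∃[ F ] lcmᶠ F ∣ᵐ u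
LcmIdeal⇒cutFamily {i} {j} (_ , (gs , gs-min , gs! , refl) , gs∣u) =
  F , subst (_∣ᵐ _) (sym (cong lcmᵐ tabulate-cut≡gs)) gs∣u
  where
  generator : ∀ t → ∃[ c ] (Surjective c × mC c ≡ lookup gs t)
  generator t = MinGen-Generated (AllV.lookup⁺ gs-min t)
  mC-generator : ∀ t → mC (proj₁ (generator t)) ≡ lookup gs t
  mC-generator = proj₂ ∘ proj₂ ∘ generator
  F : CutFamily i j
  F = record
    { cut            = proj₁ ∘ generator
    ; cut-surjective = proj₁ ∘ proj₂ ∘ generator
    ; cut-injective  = λ {t} {t'} same → UniqueV.lookup-injective gs! t t'
        (trans (sym (mC-generator t)) (trans (SameKernel⇒mC-≡ same) (mC-generator t')))
    }
  tabulate-cut≡gs : tabulate (mC ∘ cut F) ≡ gs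
  tabulate-cut≡gs = trans (tabulate-cong mC-generator) (tabulate∘lookup gs)

-- The lcm-ideals of the cut ideal

P⊆LcmIdeal : {K : ℕ} {u : Monomial (nE i)} → j < 2 ^ K → P i (suc K) u → LcmIdeal (CutIdeal i) j u
P⊆LcmIdeal {i = i} {j = j} {K = K} j<2^K (_ , (c , c-surj , refl) , c∣u) =
  Generated-∣ᵐ (lcmᶠ∈LcmIdeal F) (∣ᵐ-trans (lcmᶠ-∣ᵐ-mC F c λ t a b → cong (cut F₀ t)) c∣u)
  where
  F₀ : CutFamily (suc K) j
  F₀ = codes⇒cutFamily (nonzeroCodes j<2^K)
  F : CutFamily i j
  F = pullback c c-surj F₀

lcmᶠ∈P : {K : ℕ} → 2 ^ (K ∸ 1) ≤ j → (F : CutFamily i j) → P i (suc K) (lcmᶠ F)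
lcmᶠ∈P {j = j} {K = K} 2^K-1≤j F with d , q , q-surj , q⊑cut , coarsest ← commonRefinement F
  with suc K ℕ.≤? d
... | yes 1+K≤d = P-coarsen 1+K≤d (mC q , (q , q-surj , refl) , mC-∣ᵐ-lcmᶠ F q separated)
  where
  separated : ∀ p → Separates q p → ∃[ t ] Separates (cut F t) p
  separated (a , b) sep = ¬∀⟶∃¬ j _ (λ t → cut F t a ≟ cut F t b) (sep ∘ coarsest a b)
... | no 1+K≰d = contradiction (begin-strict
  j            <⟨ cutFamily-bound (pushforward F q q-surj q⊑cut) ⟩
  2 ^ (d ∸ 1)  ≤⟨ ℕ.^-monoʳ-≤ 2 (ℕ.∸-monoˡ-≤ 1 (ℕ.≮⇒≥ 1+K≰d)) ⟩
  2 ^ (K ∸ 1)  ≤⟨ 2^K-1≤j ⟩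
  j            ∎) (ℕ.<-irrefl refl)
  where open ℕ.≤-Reasoning

LcmIdeal⊆P : {K : ℕ} {u : Monomial (nE i)} → 2 ^ (K ∸ 1) ≤ j →
             LcmIdeal (CutIdeal i) j u → P i (suc K) u
LcmIdeal⊆P 2^K-1≤j u∈ =
  let F , F∣u = LcmIdeal⇒cutFamily u∈ in Generated-∣ᵐ (lcmᶠ∈P 2^K-1≤j F) F∣u

mainTheorem4 : (i : ℕ) → 2 ≤ i → (k : ℕ) → 1 ≤ k →
    ((j : ℕ) → 2 ^ (k ∸ 1) ≤ j → j ≤ 2 ^ k ∸ 1 →
      LcmIdeal (CutIdeal i) j ≐ P i (suc k))
    × (∃[ L ] (Unique L × length L ≡ S i (suc k) ×
        (∀ m → (m ∈ L → MinGen (P i (suc k)) m) × (MinGen (P i (suc k)) m → m ∈ L))))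
mainTheorem4 i _ k _ =
  (λ j 2^k-1≤j j≤2^k-1 _ →
     LcmIdeal⊆P 2^k-1≤j , P⊆LcmIdeal (ℕ.m≤pred[n]⇒suc[m]≤n {{ℕ.m^n≢0 2 k}} j≤2^k-1)) ,
  minimalGenerators i (suc k)
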